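{- For $k\in\{1,2,3\}$ and $n\ge 5$, let $D_k(n)$ be the digraph with vertex set $\{v_0,\ldots,v_{n-1}\}\cup\{u_0,\ldots,u_{n-1}\}$ (indices modulo $n$) and arc sets $E(D_1(n))=\{(v_i,v_{i+1}),(u_i,u_{i+2}),(v_i,u_i),(u_i,v_{i+1}) : 0\le i<n\}$, $E(D_2(n))=\{(v_i,v_{i+1}),(u_i,u_{i+2}),(u_i,v_i),(v_{i+1},u_i) : 0\le i<n\}$, $E(D_3(n))=\{(v_i,v_{i+1}),(u_{i+2},u_i),(v_i,u_i),(u_i,v_{i+1}) : 0\le i<n\}$. Then $D_1(n)$, $D_2(n)$ and $D_3(n)$ are ambi-nut digraphs for every odd $n\ge 5$.
   Context: A digraph $G$ is a finite nonempty vertex set $V(G)$ with an arbitrary binary relation $\to$ on it; $(u,v)$ is an arc if $u\to v$. Write $G^+(v)=\{u: v\to u\}$ and $G^-(v)=\{u:u\to v\}$. For $\mathbf{x}\colon V(G)\to\mathbb{R}$, $\mathbf{x}\in\operatorname{Ker} G$ iff $\sum_{u\in G^+(v)}\mathbf{x}(u)=0$ for all $v$, and $\mathbf{x}\in\operatorname{CoKer} G$ iff $\sum_{u\in G^-(v)}\mathbf{x}(u)=0$ for all $v$ (kernels of the adjacency matrix and its transpose). A vector is full if it has no zero entry. $G$ is ambi-nut if $\operatorname{Ker}G$ and $\operatorname{CoKer}G$ are both one-dimensional and both spanned by the same full vector.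
   Formalization: The vectors in Ker G and CoKer G, including the full vector spanning both, have rational entries instead of real ones. -}

module Defs where

open import Data.Nat using (ℕ; zero; suc; _+_; _%_; _≡ᵇ_; NonZero)
open import Data.Fin using (Fin; zero; suc; toℕ; splitAt)
open import Data.Bool using (Bool; true; false; if_then_else_; _∧_)
open import Data.Sum using (_⊎_; inj₁; inj₂)
open import Data.Product using (Σ; _×_; ∃)
open import Data.Rational using (ℚ; 0ℚ) renaming (_+_ to _+ℚ_; _*_ to _*ℚ_)
open import Relation.Binary.PropositionalEquality using (_≡_; _≢_)

record Digraph (m : ℕ) : Set where
  field
    arc : Fin m → Fin m → Bool
open Digraph public

∑ : ∀ {m} → (Fin m → ℚ) → ℚ
∑ {zero}  f = 0ℚ
∑ {suc m} f = f zero +ℚ ∑ (λ i → f (suc i))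

outSum : ∀ {m} → Digraph m → (Fin m → ℚ) → Fin m → ℚ
outSum G x v = ∑ (λ u → if arc G v u then x u else 0ℚ)

inSum : ∀ {m} → Digraph m → (Fin m → ℚ) → Fin m → ℚ
inSum G x v = ∑ (λ u → if arc G u v then x u else 0ℚ)

InKer : ∀ {m} → Digraph m → (Fin m → ℚ) → Set
InKer G x = ∀ v → outSum G x v ≡ 0ℚ

InCoKer : ∀ {m} → Digraph m → (Fin m → ℚ) → Set
InCoKer G x = ∀ v → inSum G x v ≡ 0ℚ

Full : ∀ {m} → (Fin m → ℚ) → Set
Full x = ∀ v → x v ≢ 0ℚ

InSpan : ∀ {m} → (Fin m → ℚ) → (Fin m → ℚ) → Set
InSpan x y = ∃ λ (c : ℚ) → ∀ v → y v ≡ c *ℚ x v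

-- Ker G and CoKer G are both one-dimensional and spanned by the same full vector x.
-- (x is full, hence nonzero, so "spanned by x" already forces dimension one.)
AmbiNut : ∀ {m} → Digraph m → Set
AmbiNut G = ∃ λ (x : Fin _ → ℚ) →
  Full x × InKer G x × InCoKer G x ×
  (∀ y → InKer G y → InSpan x y) × (∀ y → InCoKer G y → InSpan x y)

-- Vertex v_i is inj₁ i, vertex u_i is inj₂ i (via splitAt on Fin (n + n)).
-- i ≐ j + d  means  i ≡ j + d (mod n).
_≐_+_ : ∀ {n} .{{_ : NonZero n}} → Fin n → Fin n → ℕ → Bool
_≐_+_ {n} i j d = toℕ i ≡ᵇ ((toℕ j + d) % n)

mkD : (n : ℕ) → (Fin n ⊎ Fin n → Fin n ⊎ Fin n → Bool) → Digraph (n + n)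
mkD n r = record { arc = λ a b → r (splitAt n a) (splitAt n b) }

D₁ : (n : ℕ) → .{{_ : NonZero n}} → Digraph (n + n)
D₁ n = mkD n r
  where
  r : Fin n ⊎ Fin n → Fin n ⊎ Fin n → Bool
  r (inj₁ a) (inj₁ b) = b ≐ a + 1
  r (inj₂ a) (inj₂ b) = b ≐ a + 2
  r (inj₁ a) (inj₂ b) = b ≐ a + 0
  r (inj₂ a) (inj₁ b) = b ≐ a + 1

D₂ : (n : ℕ) → .{{_ : NonZero n}} → Digraph (n + n)
D₂ n = mkD n r
  where
  r : Fin n ⊎ Fin n → Fin n ⊎ Fin n → Bool
  r (inj₁ a) (inj₁ b) = b ≐ a + 1
  r (inj₂ a) (inj₂ b) = b ≐ a + 2
  r (inj₂ a) (inj₁ b) = b ≐ a + 0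
  r (inj₁ a) (inj₂ b) = a ≐ b + 1

D₃ : (n : ℕ) → .{{_ : NonZero n}} → Digraph (n + n)
D₃ n = mkD n r
  where
  r : Fin n ⊎ Fin n → Fin n ⊎ Fin n → Bool
  r (inj₁ a) (inj₁ b) = b ≐ a + 1
  r (inj₂ a) (inj₂ b) = a ≐ b + 2
  r (inj₁ a) (inj₂ b) = b ≐ a + 0
  r (inj₂ a) (inj₁ b) = b ≐ a + 1

-- Every vertex of Dₖ(n) has exactly one v-neighbour and one u-neighbour, both among its
-- out-neighbours and among its in-neighbours.  Hence the vector x₀ which is 1 on the v's and
-- −1 on the u's lies in Ker and CoKer.  Conversely, writing V k = y(v_k) and U k = y(u_k),
-- the equations at the v- and at the u-vertices read V(a + k) = −U(b + k) and
-- V(a′ + k) = −U(b′ + k).  Eliminating U shows that V is invariant under a shift by s = 2 or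
-- s = 4, besides the shift by n.  For odd n the number s is invertible modulo n (Bézout), so
-- V is invariant under the shift by 1, i.e. constant, and then U = −V.
module Submission where

open import Defs
open import Data.Nat using (ℕ; zero; suc; _+_; _*_; _%_; _/_; pred; _≤_; NonZero)
open import Data.Nat.Properties using (+-assoc; +-comm; *-suc; *-identityˡ; suc-pred; ≡ᵇ⇒≡; ≡⇒≡ᵇ; +-commutativeSemigroup)
open import Data.Nat.DivMod using (_mod_; m%n<n; m%n%n≡m%n; m<n⇒m%n≡m; %-distribˡ-+; %-remove-+ˡ; m≡m%n+[m/n]*n)
open import Data.Nat.Divisibility using (∣-refl)
open import Data.Nat.GCD using (module Bézout)
open import Data.Nat.Tactic.RingSolver using (solve-∀)
open import Algebra.Properties.CommutativeSemigroup +-commutativeSemigroup using (x∙yz≈y∙xz)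
open import Data.Fin using (Fin; zero; suc; toℕ; splitAt; join; _↑ˡ_; _↑ʳ_)
open import Data.Fin.Properties using (toℕ-fromℕ<; toℕ-injective; toℕ<n; suc-injective; 0≢1+n; splitAt-↑ˡ; splitAt-↑ʳ; splitAt-join; join-splitAt)
open import Data.Bool using (Bool; true; false; T; if_then_else_)
open import Data.Sum using (_⊎_; inj₁; inj₂)
open import Data.Product using (_×_; _,_; ∃; proj₁; proj₂)
open import Data.Empty using (⊥-elim)
open import Relation.Nullary using (¬_)
open import Data.Rational using (ℚ; 0ℚ; 1ℚ; -_) renaming (_+_ to _+ℚ_; _*_ to _*ℚ_)
import Data.Rational.Properties as ℚ
open import Algebra.Properties.Group ℚ.+-0-group using (inverseˡ-unique; inverseʳ-unique)
open import Relation.Binary.PropositionalEquality using (_≡_; refl; sym; trans; cong; cong₂; subst; module ≡-Reasoning)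
open ≡-Reasoning

module _ {A : Set} where

  Invariant : ℕ → (ℕ → A) → Set
  Invariant s F = ∀ m → F (s + m) ≡ F m

  invariant-* : ∀ {s} {F : ℕ → A} → Invariant s F → ∀ t → Invariant (t * s) F
  invariant-* inv zero    m = refl
  invariant-* {s} {F} inv (suc t) m = begin
    F (s + t * s + m)   ≡⟨ cong F (+-assoc s (t * s) m) ⟩
    F (s + (t * s + m)) ≡⟨ inv (t * s + m) ⟩
    F (t * s + m)       ≡⟨ invariant-* inv t m ⟩
    F m                 ∎

  invariant-cancel : ∀ {a b} {F : ℕ → A} → Invariant b F → Invariant (a + b) F → Invariant a F
  invariant-cancel {a} {b} {F} inv-b inv-a+b m = begin
    F (a + m)       ≡⟨ inv-b (a + m) ⟨
    F (b + (a + m)) ≡⟨ cong F (trans (sym (+-assoc b a m)) (cong (_+ m) (+-comm b a))) ⟩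
    F (a + b + m)   ≡⟨ inv-a+b m ⟩
    F m             ∎

  invariant-bézout : ∀ {a b d} {F : ℕ → A} → Invariant a F → Invariant b F →
                     Bézout.Identity d a b → Invariant d F
  invariant-bézout {F = F} inv-a inv-b (Bézout.+- x y eq) =
    invariant-cancel (invariant-* inv-b y) (subst (λ s → Invariant s F) (sym eq) (invariant-* inv-a x))
  invariant-bézout {F = F} inv-a inv-b (Bézout.-+ x y eq) =
    invariant-cancel (invariant-* inv-a x) (subst (λ s → Invariant s F) (sym eq) (invariant-* inv-b y))

  invariant-1⇒constant : ∀ {F : ℕ → A} → Invariant 1 F → ∀ m → F m ≡ F 0
  invariant-1⇒constant inv zero    = refl
  invariant-1⇒constant inv (suc m) = trans (inv m) (invariant-1⇒constant inv m)

  module _ {n} .{{_ : NonZero n}} where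

    invariant-shift-back : ∀ {F : ℕ → A} → Invariant n F → ∀ x m → F (x + (x * pred n + m)) ≡ F m
    invariant-shift-back {F} inv x m = begin
      F (x + (x * pred n + m)) ≡⟨ cong F (+-assoc x (x * pred n) m) ⟨
      F (x + x * pred n + m)   ≡⟨ cong (λ k → F (k + m)) (*-suc x (pred n)) ⟨
      F (x * suc (pred n) + m) ≡⟨ cong (λ k → F (x * k + m)) (suc-pred n) ⟩
      F (x * n + m)            ≡⟨ invariant-* inv x m ⟩
      F m                      ∎

    invariant-unshift : ∀ {s x} {F : ℕ → A} → Invariant n F → Invariant s (λ m → F (x + m)) → Invariant s F
    invariant-unshift {s} {x} {F} per inv m = begin
      F (s + m)                      ≡⟨ invariant-shift-back per x (s + m) ⟨
      F (x + (x * pred n + (s + m))) ≡⟨ cong (λ k → F (x + k)) (x∙yz≈y∙xz (x * pred n) s m) ⟩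
      F (x + (s + (x * pred n + m))) ≡⟨ inv (x * pred n + m) ⟩
      F (x + (x * pred n + m))       ≡⟨ invariant-shift-back per x m ⟩
      F m                            ∎

module _ {n} (odd : n % 2 ≡ 1) where

  private
    h : ℕ
    h = n / 2

    n≡1+h*2 : n ≡ 1 + h * 2
    n≡1+h*2 = trans (m≡m%n+[m/n]*n n 2) (cong (_+ h * 2) odd)

  odd⇒bézout-2 : Bézout.Identity 1 2 n
  odd⇒bézout-2 = Bézout.-+ h 1 (sym (trans (*-identityˡ n) n≡1+h*2))

  -- 4 (h + 1)² = (n + 1)² = 1 + (n + 2) n
  odd⇒bézout-4 : Bézout.Identity 1 4 n
  odd⇒bézout-4 = Bézout.+- ((1 + h) * (1 + h)) (n + 2) (begin
    1 + (n + 2) * n                     ≡⟨ cong (λ k → 1 + (k + 2) * k) n≡1+h*2 ⟩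
    1 + (1 + h * 2 + 2) * (1 + h * 2)   ≡⟨ square h ⟩
    (1 + h) * (1 + h) * 4               ∎)
    where
    square : ∀ m → 1 + (1 + m * 2 + 2) * (1 + m * 2) ≡ (1 + m) * (1 + m) * 4
    square = solve-∀

if-T : ∀ {b} {x : ℚ} → T b → (if b then x else 0ℚ) ≡ x
if-T {true} _ = refl

if-¬T : ∀ {b} {x : ℚ} → ¬ T b → (if b then x else 0ℚ) ≡ 0ℚ
if-¬T {false} _  = refl
if-¬T {true}  ¬t = ⊥-elim (¬t _)

∑-cong : ∀ {m} {f g : Fin m → ℚ} → (∀ i → f i ≡ g i) → ∑ f ≡ ∑ g
∑-cong {zero}  eq = refl
∑-cong {suc m} eq = cong₂ _+ℚ_ (eq zero) (∑-cong (λ i → eq (suc i)))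

∑-zero : ∀ {m} {f : Fin m → ℚ} → (∀ i → f i ≡ 0ℚ) → ∑ f ≡ 0ℚ
∑-zero {zero}  eq = refl
∑-zero {suc m} eq = trans (cong₂ _+ℚ_ (eq zero) (∑-zero (λ i → eq (suc i)))) (ℚ.+-identityʳ 0ℚ)

∑-++ : ∀ m {k} (f : Fin (m + k) → ℚ) → ∑ f ≡ ∑ (λ i → f (i ↑ˡ k)) +ℚ ∑ (λ j → f (m ↑ʳ j))
∑-++ zero    f = sym (ℚ.+-identityˡ _)
∑-++ (suc m) f = trans (cong (f zero +ℚ_) (∑-++ m (λ i → f (suc i))))
                       (sym (ℚ.+-assoc (f zero) _ _))

∑-select : ∀ {m} (P : Fin m → Bool) (g : Fin m → ℚ) {j₀} → T (P j₀) → (∀ j → T (P j) → j ≡ j₀) →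
           ∑ (λ j → if P j then g j else 0ℚ) ≡ g j₀
∑-select P g {zero} Pj₀ unique =
  trans (cong₂ _+ℚ_ (if-T Pj₀) (∑-zero (λ j → if-¬T (λ Pj → 0≢1+n (sym (unique (suc j) Pj))))))
        (ℚ.+-identityʳ _)
∑-select P g {suc j₀} Pj₀ unique =
  trans (cong₂ _+ℚ_ (if-¬T (λ P0 → 0≢1+n (unique zero P0)))
                    (∑-select (λ j → P (suc j)) (λ j → g (suc j)) Pj₀ (λ j Pj → suc-injective (unique (suc j) Pj))))
        (ℚ.+-identityˡ _)

module TwoCycles (n : ℕ) .{{_ : NonZero n}} where

  toℕ-mod : ∀ k → toℕ (k mod n) ≡ k % n
  toℕ-mod k = toℕ-fromℕ< (m%n<n k n)

  %-invariant : Invariant n (_% n)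
  %-invariant m = %-remove-+ˡ m ∣-refl

  mod-invariant : Invariant n (_mod n)
  mod-invariant m = toℕ-injective (trans (toℕ-mod (n + m)) (trans (%-invariant m) (sym (toℕ-mod m))))

  %-+-congˡ : ∀ c {a b} → a % n ≡ b % n → (c + a) % n ≡ (c + b) % n
  %-+-congˡ c {a} {b} eq = begin
    (c + a) % n           ≡⟨ %-distribˡ-+ c a n ⟩
    (c % n + a % n) % n   ≡⟨ cong (λ t → (c % n + t) % n) eq ⟩
    (c % n + b % n) % n   ≡⟨ %-distribˡ-+ c b n ⟨
    (c + b) % n           ∎

  %-+-cancelˡ : ∀ d {x y} → (d + x) % n ≡ (d + y) % n → x % n ≡ y % n
  %-+-cancelˡ d {x} {y} eq = begin
    x % n                        ≡⟨ invariant-shift-back %-invariant d x ⟨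
    (d + (d * pred n + x)) % n   ≡⟨ cong (_% n) (x∙yz≈y∙xz d (d * pred n) x) ⟩
    (d * pred n + (d + x)) % n   ≡⟨ %-+-congˡ (d * pred n) eq ⟩
    (d * pred n + (d + y)) % n   ≡⟨ cong (_% n) (x∙yz≈y∙xz d (d * pred n) y) ⟨
    (d + (d * pred n + y)) % n   ≡⟨ invariant-shift-back %-invariant d y ⟩
    y % n                        ∎

  mod-+-surjective : ∀ d (a : Fin n) → (d + (d * pred n + toℕ a)) mod n ≡ a
  mod-+-surjective d a = toℕ-injective (begin
    toℕ ((d + (d * pred n + toℕ a)) mod n) ≡⟨ toℕ-mod _ ⟩
    (d + (d * pred n + toℕ a)) % n         ≡⟨ invariant-shift-back %-invariant d (toℕ a) ⟩
    toℕ a % n                              ≡⟨ m<n⇒m%n≡m (toℕ<n a) ⟩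
    toℕ a                                  ∎)

  toℕ-mod-+ : ∀ d k → (toℕ (k mod n) + d) % n ≡ toℕ ((d + k) mod n)
  toℕ-mod-+ d k = begin
    (toℕ (k mod n) + d) % n  ≡⟨ cong (λ t → (t + d) % n) (toℕ-mod k) ⟩
    (k % n + d) % n          ≡⟨ cong (_% n) (+-comm (k % n) d) ⟩
    (d + k % n) % n          ≡⟨ %-+-congˡ d (m%n%n≡m%n k n) ⟩
    (d + k) % n              ≡⟨ toℕ-mod (d + k) ⟨
    toℕ ((d + k) mod n)      ∎

  ∑-≐-ahead : ∀ d k (g : Fin n → ℚ) → ∑ (λ j → if j ≐ (k mod n) + d then g j else 0ℚ) ≡ g ((d + k) mod n)
  ∑-≐-ahead d k g = ∑-select _ g (≡⇒≡ᵇ _ _ (sym (toℕ-mod-+ d k)))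
    (λ j eq → toℕ-injective (trans (≡ᵇ⇒≡ _ _ eq) (toℕ-mod-+ d k)))

  ∑-≐-behind : ∀ d k (g : Fin n → ℚ) → ∑ (λ j → if ((d + k) mod n) ≐ j + d then g j else 0ℚ) ≡ g (k mod n)
  ∑-≐-behind d k g = ∑-select _ g (≡⇒≡ᵇ _ _ (sym (toℕ-mod-+ d k))) unique
    where
    unique : ∀ j → T (((d + k) mod n) ≐ j + d) → j ≡ k mod n
    unique j eq = toℕ-injective (begin
      toℕ j          ≡⟨ m<n⇒m%n≡m (toℕ<n j) ⟨
      toℕ j % n      ≡⟨ %-+-cancelˡ d (begin
        (d + toℕ j) % n      ≡⟨ cong (_% n) (+-comm d (toℕ j)) ⟩
        (toℕ j + d) % n      ≡⟨ ≡ᵇ⇒≡ _ _ eq ⟨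
        toℕ ((d + k) mod n)  ≡⟨ toℕ-mod (d + k) ⟩
        (d + k) % n          ∎) ⟩
      k % n          ≡⟨ toℕ-mod k ⟨
      toℕ (k mod n)  ∎)

  v u : ℕ → Fin (n + n)
  v k = (k mod n) ↑ˡ n
  u k = n ↑ʳ (k mod n)

  vertex-cases : ∀ c d w → (∃ λ k → w ≡ v (c + k)) ⊎ (∃ λ k → w ≡ u (d + k))
  vertex-cases c d w with splitAt n w | join-splitAt n n w
  ... | inj₁ a | refl = inj₁ (_ , cong (_↑ˡ n) (sym (mod-+-surjective c a)))
  ... | inj₂ a | refl = inj₂ (_ , cong (n ↑ʳ_) (sym (mod-+-surjective d a)))

  sign : Fin n ⊎ Fin n → ℚ
  sign (inj₁ _) = 1ℚ
  sign (inj₂ _) = - 1ℚ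

  x₀ : Fin (n + n) → ℚ
  x₀ w = sign (splitAt n w)

  x₀-v : ∀ k → x₀ (v k) ≡ 1ℚ
  x₀-v k = cong sign (splitAt-↑ˡ n (k mod n) n)

  x₀-u : ∀ k → x₀ (u k) ≡ - 1ℚ
  x₀-u k = cong sign (splitAt-↑ʳ n n (k mod n))

  x₀-full : Full x₀
  x₀-full w with splitAt n w
  ... | inj₁ _ = λ ()
  ... | inj₂ _ = λ ()

  x₀-span : ∀ (y : Fin (n + n) → ℚ) c → (∀ k → y (v k) ≡ c) → (∀ k → y (u k) ≡ - c) → InSpan x₀ y
  x₀-span y c yv yu = c , λ w → scaled w (vertex-cases 0 0 w)
    where
    scaled : ∀ w → (∃ λ k → w ≡ v k) ⊎ (∃ λ k → w ≡ u k) → y w ≡ c *ℚ x₀ w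
    scaled w (inj₁ (k , refl)) = begin
      y (v k)        ≡⟨ yv k ⟩
      c              ≡⟨ ℚ.*-identityʳ c ⟨
      c *ℚ 1ℚ        ≡⟨ cong (c *ℚ_) (x₀-v k) ⟨
      c *ℚ x₀ (v k)  ∎
    scaled w (inj₂ (k , refl)) = begin
      y (u k)        ≡⟨ yu k ⟩
      - c            ≡⟨ cong -_ (ℚ.*-identityʳ c) ⟨
      - (c *ℚ 1ℚ)    ≡⟨ ℚ.neg-distribʳ-* c 1ℚ ⟩
      c *ℚ - 1ℚ      ≡⟨ cong (c *ℚ_) (x₀-u k) ⟨
      c *ℚ x₀ (u k)  ∎

  Opposite : ℕ → ℕ → (ℕ → ℚ) → (ℕ → ℚ) → Set
  Opposite a b V U = ∀ k → V (a + k) +ℚ U (b + k) ≡ 0ℚ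

  opposite-drift : ∀ {a b a′ b′ V U} → Opposite a b V U → Opposite a′ b′ V U →
                   ∀ m → V (a + b′ + m) ≡ V (a′ + b + m)
  opposite-drift {a} {b} {a′} {b′} {V} {U} E E′ m = begin
    V (a + b′ + m)      ≡⟨ cong V (+-assoc a b′ m) ⟩
    V (a + (b′ + m))    ≡⟨ inverseˡ-unique _ _ (E (b′ + m)) ⟩
    - U (b + (b′ + m))  ≡⟨ cong (λ k → - U k) (x∙yz≈y∙xz b b′ m) ⟩
    - U (b′ + (b + m))  ≡⟨ inverseˡ-unique _ _ (E′ (b + m)) ⟨
    V (a′ + (b + m))    ≡⟨ cong V (+-assoc a′ b m) ⟨
    V (a′ + b + m)      ∎

  opposite-constant : ∀ {a b a′ b′ s V U} → Invariant n V → Invariant n U → Bézout.Identity 1 s n →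
                      Opposite a b V U → Opposite a′ b′ V U → a + b′ ≡ a′ + b + s →
                      (∀ k → V k ≡ V 0) × (∀ k → U k ≡ - V 0)
  opposite-constant {a} {b} {a′} {b′} {s} {V} {U} per-V per-U bézout E E′ drift = V-constant , U-constant
    where
    shifted : Invariant s (λ m → V (a′ + b + m))
    shifted m = begin
      V (a′ + b + (s + m))  ≡⟨ cong V (+-assoc (a′ + b) s m) ⟨
      V (a′ + b + s + m)    ≡⟨ cong (λ t → V (t + m)) drift ⟨
      V (a + b′ + m)        ≡⟨ opposite-drift {a} {b} {a′} {b′} {V} {U} E E′ m ⟩
      V (a′ + b + m)        ∎

    V-constant : ∀ k → V k ≡ V 0
    V-constant = invariant-1⇒constant (invariant-bézout (invariant-unshift per-V shifted) per-V bézout)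

    U-constant : ∀ k → U k ≡ - V 0
    U-constant k = begin
      U k                         ≡⟨ invariant-shift-back per-U b k ⟨
      U (b + (b * pred n + k))    ≡⟨ inverseʳ-unique _ _ (E (b * pred n + k)) ⟩
      - V (a + (b * pred n + k))  ≡⟨ cong -_ (V-constant _) ⟩
      - V 0                       ∎

  -- Offsets are added on the left so that composite ones, such as 1 + (2 + k), reduce to
  -- literals such as 3 + k.
  record OffsetSum (S : (Fin (n + n) → ℚ) → Fin (n + n) → ℚ) : Set where
    field
      cᵥ aᵥ bᵥ : ℕ
      at-v : ∀ y k → S y (v (cᵥ + k)) ≡ y (v (aᵥ + k)) +ℚ y (u (bᵥ + k))
      cᵤ aᵤ bᵤ : ℕ
      at-u : ∀ y k → S y (u (cᵤ + k)) ≡ y (v (aᵤ + k)) +ℚ y (u (bᵤ + k))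

    Drift : ℕ → Set
    Drift s = aᵥ + bᵤ ≡ aᵤ + bᵥ + s ⊎ aᵤ + bᵥ ≡ aᵥ + bᵤ + s

  module _ {S} (T : OffsetSum S) where
    open OffsetSum T

    x₀-annihilated : ∀ w → S x₀ w ≡ 0ℚ
    x₀-annihilated w with vertex-cases cᵥ cᵤ w
    ... | inj₁ (k , refl) = trans (at-v x₀ k) (trans (cong₂ _+ℚ_ (x₀-v _) (x₀-u _)) (ℚ.+-inverseʳ 1ℚ))
    ... | inj₂ (k , refl) = trans (at-u x₀ k) (trans (cong₂ _+ℚ_ (x₀-v _) (x₀-u _)) (ℚ.+-inverseʳ 1ℚ))

    annihilated⇒span : ∀ {s} → Bézout.Identity 1 s n → Drift s →
                       ∀ y → (∀ w → S y w ≡ 0ℚ) → InSpan x₀ y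
    annihilated⇒span {s} bézout drift y zero-sum = x₀-span y _ (proj₁ (constant drift)) (proj₂ (constant drift))
      where
      V U : ℕ → ℚ
      V k = y (v k)
      U k = y (u k)

      per-V : Invariant n V
      per-V m = cong (λ i → y (i ↑ˡ n)) (mod-invariant m)

      per-U : Invariant n U
      per-U m = cong (λ i → y (n ↑ʳ i)) (mod-invariant m)

      Eᵥ : Opposite aᵥ bᵥ V U
      Eᵥ k = trans (sym (at-v y k)) (zero-sum _)

      Eᵤ : Opposite aᵤ bᵤ V U
      Eᵤ k = trans (sym (at-u y k)) (zero-sum _)

      constant : Drift s → (∀ k → V k ≡ V 0) × (∀ k → U k ≡ - V 0)
      constant (inj₁ eq) = opposite-constant per-V per-U bézout Eᵥ Eᵤ eq
      constant (inj₂ eq) = opposite-constant per-V per-U bézout Eᵤ Eᵥ eq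

  ambiNut : ∀ (G : Digraph (n + n)) {s} → Bézout.Identity 1 s n →
            (K : OffsetSum (outSum G)) → OffsetSum.Drift K s →
            (C : OffsetSum (inSum G)) → OffsetSum.Drift C s → AmbiNut G
  ambiNut G bézout K drift-K C drift-C =
    x₀ , x₀-full , x₀-annihilated K , x₀-annihilated C ,
    annihilated⇒span K bézout drift-K , annihilated⇒span C bézout drift-C

  Arcs : Set
  Arcs = Fin n ⊎ Fin n → Fin n ⊎ Fin n → Bool

  HasArcs : Digraph (n + n) → Arcs → Set
  HasArcs G r = ∀ a b → arc G a b ≡ r (splitAt n a) (splitAt n b)

  arc-join : ∀ {G} r → HasArcs G r → ∀ s t → arc G (join n n s) (join n n t) ≡ r s t
  arc-join r arcs s t = trans (arcs _ _) (cong₂ r (splitAt-join n n s) (splitAt-join n n t))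

  outSum-by : ∀ {G} r → HasArcs G r → ∀ y s {p q} →
              ∑ (λ i → if r s (inj₁ i) then y (i ↑ˡ n) else 0ℚ) ≡ p →
              ∑ (λ j → if r s (inj₂ j) then y (n ↑ʳ j) else 0ℚ) ≡ q →
              outSum G y (join n n s) ≡ p +ℚ q
  outSum-by r arcs y s eq-v eq-u = trans (∑-++ n _) (cong₂ _+ℚ_
    (trans (∑-cong (λ i → cong (λ b → if b then _ else 0ℚ) (arc-join r arcs s (inj₁ i)))) eq-v)
    (trans (∑-cong (λ j → cong (λ b → if b then _ else 0ℚ) (arc-join r arcs s (inj₂ j)))) eq-u))

  inSum-by : ∀ {G} r → HasArcs G r → ∀ y t {p q} →
             ∑ (λ i → if r (inj₁ i) t then y (i ↑ˡ n) else 0ℚ) ≡ p →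
             ∑ (λ j → if r (inj₂ j) t then y (n ↑ʳ j) else 0ℚ) ≡ q →
             inSum G y (join n n t) ≡ p +ℚ q
  inSum-by r arcs y t eq-v eq-u = trans (∑-++ n _) (cong₂ _+ℚ_
    (trans (∑-cong (λ i → cong (λ b → if b then _ else 0ℚ) (arc-join r arcs (inj₁ i) t))) eq-v)
    (trans (∑-cong (λ j → cong (λ b → if b then _ else 0ℚ) (arc-join r arcs (inj₂ j) t))) eq-u))

  -- The relations from which D₁, D₂, D₃ are built are local to their definitions and
  -- cannot be named, hence these copies.
  arcs₁ arcs₂ arcs₃ : Arcs
  arcs₁ (inj₁ a) (inj₁ b) = b ≐ a + 1
  arcs₁ (inj₂ a) (inj₂ b) = b ≐ a + 2
  arcs₁ (inj₁ a) (inj₂ b) = b ≐ a + 0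
  arcs₁ (inj₂ a) (inj₁ b) = b ≐ a + 1
  arcs₂ (inj₁ a) (inj₁ b) = b ≐ a + 1
  arcs₂ (inj₂ a) (inj₂ b) = b ≐ a + 2
  arcs₂ (inj₂ a) (inj₁ b) = b ≐ a + 0
  arcs₂ (inj₁ a) (inj₂ b) = a ≐ b + 1
  arcs₃ (inj₁ a) (inj₁ b) = b ≐ a + 1
  arcs₃ (inj₂ a) (inj₂ b) = a ≐ b + 2
  arcs₃ (inj₁ a) (inj₂ b) = b ≐ a + 0
  arcs₃ (inj₂ a) (inj₁ b) = b ≐ a + 1

  D₁-arcs : HasArcs (D₁ n) arcs₁
  D₁-arcs a b with splitAt n a | splitAt n b
  ... | inj₁ _ | inj₁ _ = refl
  ... | inj₁ _ | inj₂ _ = refl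
  ... | inj₂ _ | inj₁ _ = refl
  ... | inj₂ _ | inj₂ _ = refl

  D₂-arcs : HasArcs (D₂ n) arcs₂
  D₂-arcs a b with splitAt n a | splitAt n b
  ... | inj₁ _ | inj₁ _ = refl
  ... | inj₁ _ | inj₂ _ = refl
  ... | inj₂ _ | inj₁ _ = refl
  ... | inj₂ _ | inj₂ _ = refl

  D₃-arcs : HasArcs (D₃ n) arcs₃
  D₃-arcs a b with splitAt n a | splitAt n b
  ... | inj₁ _ | inj₁ _ = refl
  ... | inj₁ _ | inj₂ _ = refl
  ... | inj₂ _ | inj₁ _ = refl
  ... | inj₂ _ | inj₂ _ = refl

  D₁-out : OffsetSum (outSum (D₁ n))
  D₁-out = record
    { cᵥ = 0 ; aᵥ = 1 ; bᵥ = 0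
    ; at-v = λ y k → outSum-by arcs₁ D₁-arcs y (inj₁ (k mod n)) (∑-≐-ahead 1 k _) (∑-≐-ahead 0 k _)
    ; cᵤ = 0 ; aᵤ = 1 ; bᵤ = 2
    ; at-u = λ y k → outSum-by arcs₁ D₁-arcs y (inj₂ (k mod n)) (∑-≐-ahead 1 k _) (∑-≐-ahead 2 k _)
    }

  D₁-in : OffsetSum (inSum (D₁ n))
  D₁-in = record
    { cᵥ = 1 ; aᵥ = 0 ; bᵥ = 0
    ; at-v = λ y k → inSum-by arcs₁ D₁-arcs y (inj₁ ((1 + k) mod n)) (∑-≐-behind 1 k _) (∑-≐-behind 1 k _)
    ; cᵤ = 2 ; aᵤ = 2 ; bᵤ = 0
    ; at-u = λ y k → inSum-by arcs₁ D₁-arcs y (inj₂ ((2 + k) mod n)) (∑-≐-behind 0 (2 + k) _) (∑-≐-behind 2 k _)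
    }

  D₂-out : OffsetSum (outSum (D₂ n))
  D₂-out = record
    { cᵥ = 1 ; aᵥ = 2 ; bᵥ = 0
    ; at-v = λ y k → outSum-by arcs₂ D₂-arcs y (inj₁ ((1 + k) mod n)) (∑-≐-ahead 1 (1 + k) _) (∑-≐-behind 1 k _)
    ; cᵤ = 0 ; aᵤ = 0 ; bᵤ = 2
    ; at-u = λ y k → outSum-by arcs₂ D₂-arcs y (inj₂ (k mod n)) (∑-≐-ahead 0 k _) (∑-≐-ahead 2 k _)
    }

  D₂-in : OffsetSum (inSum (D₂ n))
  D₂-in = record
    { cᵥ = 1 ; aᵥ = 0 ; bᵥ = 1
    ; at-v = λ y k → inSum-by arcs₂ D₂-arcs y (inj₁ ((1 + k) mod n)) (∑-≐-behind 1 k _) (∑-≐-behind 0 (1 + k) _)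
    ; cᵤ = 2 ; aᵤ = 3 ; bᵤ = 0
    ; at-u = λ y k → inSum-by arcs₂ D₂-arcs y (inj₂ ((2 + k) mod n)) (∑-≐-ahead 1 (2 + k) _) (∑-≐-behind 2 k _)
    }

  D₃-out : OffsetSum (outSum (D₃ n))
  D₃-out = record
    { cᵥ = 0 ; aᵥ = 1 ; bᵥ = 0
    ; at-v = λ y k → outSum-by arcs₃ D₃-arcs y (inj₁ (k mod n)) (∑-≐-ahead 1 k _) (∑-≐-ahead 0 k _)
    ; cᵤ = 2 ; aᵤ = 3 ; bᵤ = 0
    ; at-u = λ y k → outSum-by arcs₃ D₃-arcs y (inj₂ ((2 + k) mod n)) (∑-≐-ahead 1 (2 + k) _) (∑-≐-behind 2 k _)
    }

  D₃-in : OffsetSum (inSum (D₃ n))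
  D₃-in = record
    { cᵥ = 1 ; aᵥ = 0 ; bᵥ = 0
    ; at-v = λ y k → inSum-by arcs₃ D₃-arcs y (inj₁ ((1 + k) mod n)) (∑-≐-behind 1 k _) (∑-≐-behind 1 k _)
    ; cᵤ = 0 ; aᵤ = 0 ; bᵤ = 2
    ; at-u = λ y k → inSum-by arcs₃ D₃-arcs y (inj₂ (k mod n)) (∑-≐-behind 0 k _) (∑-≐-ahead 2 k _)
    }

open TwoCycles

proposition8 : (n : ℕ) .{{_ : NonZero n}} → 5 ≤ n → n % 2 ≡ 1 →
    AmbiNut (D₁ n) × AmbiNut (D₂ n) × AmbiNut (D₃ n)
proposition8 n _ odd =
  ambiNut n (D₁ n) (odd⇒bézout-2 odd) (D₁-out n) (inj₁ refl) (D₁-in n) (inj₂ refl) ,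
  ambiNut n (D₂ n) (odd⇒bézout-4 odd) (D₂-out n) (inj₁ refl) (D₂-in n) (inj₂ refl) ,
  ambiNut n (D₃ n) (odd⇒bézout-2 odd) (D₃-out n) (inj₂ refl) (D₃-in n) (inj₁ refl)
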